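{- Let $G$ be a graph of order $n$, and set $d := 2\log_2 n + 1$. Then there exists an orientation $\vec{G}$ of $G$ such that every acyclic set of vertices in $\vec{G}$ is $d$-sparse in $G$.
   Context: A set of vertices of a digraph is acyclic if it induces an acyclic subdigraph (a subdigraph with no directed cycle). A set $X \subseteq V(G)$ is $d$-sparse in $G$ if the average degree of the induced subgraph $G[X]$ is at most $d$. An orientation of a graph is obtained by replacing each edge by exactly one of its two possible arcs. -}

module Defs where

open import Data.Nat using (ℕ; zero; suc; _+_; _*_; _∸_; _^_; _≤_)
open import Data.Fin using (Fin; zero; suc)
open import Data.Bool using (Bool; true; false; if_then_else_)
open import Data.Fin.Subset using (Subset; _∈_; ∣_∣)
open import Data.Vec using (lookup)
open import Data.Product using (_×_)
open import Data.Sum using (_⊎_)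
open import Relation.Nullary using (¬_)
open import Relation.Binary.PropositionalEquality using (_≡_)

record Graph (n : ℕ) : Set where
  field
    Adj    : Fin n → Fin n → Bool
    sym    : ∀ u v → Adj u v ≡ Adj v u
    irrefl : ∀ v → Adj v v ≡ false
open Graph public

record Orientation {n : ℕ} (G : Graph n) : Set where
  field
    Arc       : Fin n → Fin n → Bool
    arc⇒edge  : ∀ u v → Arc u v ≡ true → Adj G u v ≡ true
    edge⇒arc  : ∀ u v → Adj G u v ≡ true → (Arc u v ≡ true) ⊎ (Arc v u ≡ true)
    notBoth   : ∀ u v → Arc u v ≡ true → Arc v u ≡ false
open Orientation public

data Walk {n : ℕ} {G : Graph n} (D : Orientation G) (X : Subset n) : Fin n → Fin n → Set where
  arc  : ∀ {u v} → u ∈ X → v ∈ X → Arc D u v ≡ true → Walk D X u v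
  _∷_  : ∀ {u v w} → Walk D X u v → Walk D X v w → Walk D X u w

-- X is acyclic in D: the induced subdigraph D[X] has no directed cycle
-- (equivalently, no closed directed walk with at least one arc).
Acyclic : {n : ℕ} {G : Graph n} → Orientation G → Subset n → Set
Acyclic D X = ∀ v → ¬ Walk D X v v

sumFin : (n : ℕ) → (Fin n → ℕ) → ℕ
sumFin zero    f = 0
sumFin (suc n) f = f zero + sumFin n (λ i → f (suc i))

-- Sum of the degrees in the induced subgraph G[X] (= 2 |E(G[X])|).
degSum : {n : ℕ} → Graph n → Subset n → ℕ
degSum {n} G X =
  sumFin n (λ u → sumFin n (λ v →
    if lookup X u then (if lookup X v then (if Adj G u v then 1 else 0) else 0) else 0))

-- X is (2 log₂ n + 1)-sparse in G, where n is the order of G: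
--   degSum / |X| ≤ 2 log₂ n + 1   (average degree; empty X has average degree 0)
-- ⇔ degSum ∸ |X| ≤ 2 |X| log₂ n
-- ⇔ 2 ^ (degSum ∸ |X|) ≤ n ^ (2 |X|)       (real-free form)
LogSparse : {n : ℕ} → Graph n → Subset n → Set
LogSparse {n} G X = 2 ^ (degSum G X ∸ ∣ X ∣) ≤ n ^ (2 * ∣ X ∣)

module Submission where

-- Orient each edge uv with u < v by an independent fair bit; concretely, count over all 2^(n·n)
-- assignments f of bits to ordered pairs of vertices.  An acyclic set X of size k has a sink-first
-- (reverse topological) ordering s, and for a fixed sequence s of distinct vertices this prescribes
-- the e(X) bits of the edges inside X, so it holds for exactly a 2^-e(X) fraction of all f.  If X is
-- not sparse then 2e(X) - k > 2k log₂ n, which together with 2e(X) ≤ k(k-1) yields 2^e(X) ≥ 2n·n^k.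
-- Summing over the n^k sequences of each length 1 ≤ k ≤ n, at most half of all f admit an acyclic
-- non-sparse set, so some f admits none.

open import Defs renaming (sym to Adj-sym)
open import Data.Nat using (ℕ; zero; suc; _+_; _*_; _∸_; _^_; _≤_; _<_; z≤n; s≤s; NonZero; >-nonZero⁻¹)
open import Data.Nat.Properties hiding (<-cmp)
open import Algebra.Properties.CommutativeMonoid.Sum +-0-commutativeMonoid
  using (sum; sum-cong-≗; ∑-distrib-+; ∑-comm)
open import Algebra.Properties.Semiring.Sum +-*-semiring using (*-distribʳ-sum)
open import Algebra.Properties.CommutativeSemigroup +-commutativeSemigroup
  using () renaming (interchange to +-interchange)
open import Algebra.Properties.CommutativeSemigroup *-commutativeSemigroup
  using () renaming (interchange to *-interchange)
open import Data.Nat.Solver using (module +-*-Solver)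
open import Data.Bool using (Bool; true; false; if_then_else_; _∧_; _∨_; not)
open import Data.Bool.Properties using (not-involutive) renaming (_≟_ to _≟ᵇ_)
open import Data.Maybe using (Maybe; just; nothing; is-just)
open import Data.Fin using (Fin; zero; suc; toℕ; fromℕ<; combine; remQuot; _↑ˡ_; _↑ʳ_)
open import Data.Fin.Properties
  using (pigeonhole; any?; <-cmp; toℕ-fromℕ<; remQuot-combine; combine-remQuot)
  renaming (_≟_ to _≟ᶠ_; _<?_ to _<?ᶠ_)
open import Data.Fin.Subset using (Subset; _⊆_; _∈_; ∣_∣; ⊥; ⁅_⁆; _∪_; _-_; inside; outside)
open import Data.Fin.Subset.Properties
  using ( x∈p∪q⁻; x∈⁅y⁆⇒x≡y; x∈p∧x≢y⇒x∈p-y; ∪-identityˡ; p─⊥≡p; ∉⊥; _∈?_; p─q⊆p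
        ; nonempty?; Empty-unique; ∣⊥∣≡0; ∣p∣≤n)
open import Data.Vec using (Vec; []; _∷_; here; there; lookup)
open import Data.Vec.Properties using ([]=⇒lookup; lookup⇒[]=)
open import Data.Vec.Functional using (head; tail) renaming ([] to []ᶠ; _∷_ to _∷ᶠ_)
open import Data.Unit using (⊤; tt)
open import Data.Product using (Σ; ∃; _×_; _,_; proj₁; proj₂)
open import Data.Sum using (_⊎_; inj₁; inj₂)
open import Relation.Nullary using (¬_; ¬?; Dec; does; yes; no; contradiction; _×-dec_)
open import Relation.Nullary.Decidable using (decidable-stable; dec-true; dec-false)
open import Relation.Binary using (tri<; tri≈; tri>)
open import Relation.Binary.PropositionalEquality

-- Finite sums

sumFin≡sum : ∀ n (f : Fin n → ℕ) → sumFin n f ≡ sum f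
sumFin≡sum zero    f = refl
sumFin≡sum (suc n) f = cong (f zero +_) (sumFin≡sum n (λ i → f (suc i)))

sumFin-cong : ∀ n {f g : Fin n → ℕ} → (∀ i → f i ≡ g i) → sumFin n f ≡ sumFin n g
sumFin-cong zero    f≗g = refl
sumFin-cong (suc n) f≗g = cong₂ _+_ (f≗g zero) (sumFin-cong n (λ i → f≗g (suc i)))

sumFin-mono-≤ : ∀ n {f g : Fin n → ℕ} → (∀ i → f i ≤ g i) → sumFin n f ≤ sumFin n g
sumFin-mono-≤ zero    f≤g = z≤n
sumFin-mono-≤ (suc n) f≤g = +-mono-≤ (f≤g zero) (sumFin-mono-≤ n (λ i → f≤g (suc i)))

sumFin-≤-* : ∀ n {f : Fin n → ℕ} {b} → (∀ i → f i ≤ b) → sumFin n f ≤ n * b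
sumFin-≤-* zero    f≤b = z≤n
sumFin-≤-* (suc n) f≤b = +-mono-≤ (f≤b zero) (sumFin-≤-* n (λ i → f≤b (suc i)))

sumFin-distrib-+ : ∀ n (f g : Fin n → ℕ) →
  sumFin n (λ i → f i + g i) ≡ sumFin n f + sumFin n g
sumFin-distrib-+ n f g = begin
  sumFin n (λ i → f i + g i) ≡⟨ sumFin≡sum n _ ⟩
  sum (λ i → f i + g i)      ≡⟨ ∑-distrib-+ f g ⟩
  sum f + sum g              ≡⟨ sym (cong₂ _+_ (sumFin≡sum n f) (sumFin≡sum n g)) ⟩
  sumFin n f + sumFin n g    ∎
  where open ≡-Reasoning

sumFin-distribʳ-* : ∀ n (f : Fin n → ℕ) c → sumFin n f * c ≡ sumFin n (λ i → f i * c)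
sumFin-distribʳ-* n f c = begin
  sumFin n f * c          ≡⟨ cong (_* c) (sumFin≡sum n f) ⟩
  sum f * c               ≡⟨ *-distribʳ-sum c f ⟩
  sum (λ i → f i * c)     ≡⟨ sym (sumFin≡sum n _) ⟩
  sumFin n (λ i → f i * c) ∎
  where open ≡-Reasoning

sumFin-comm : ∀ m n (f : Fin m → Fin n → ℕ) →
  sumFin m (λ i → sumFin n (f i)) ≡ sumFin n (λ j → sumFin m (λ i → f i j))
sumFin-comm m n f = begin
  sumFin m (λ i → sumFin n (f i))           ≡⟨ double m n f ⟩
  sum (λ i → sum (f i))                      ≡⟨ ∑-comm f ⟩
  sum (λ j → sum (λ i → f i j))              ≡⟨ sym (double n m (λ j i → f i j)) ⟩
  sumFin n (λ j → sumFin m (λ i → f i j))   ∎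
  where
  open ≡-Reasoning
  double : ∀ a b (g : Fin a → Fin b → ℕ) → sumFin a (λ i → sumFin b (g i)) ≡ sum (λ i → sum (g i))
  double a b g = trans (sumFin≡sum a _) (sum-cong-≗ (λ i → sumFin≡sum b (g i)))

sumFin-++ : ∀ a b (f : Fin (a + b) → ℕ) →
  sumFin (a + b) f ≡ sumFin a (λ i → f (i ↑ˡ b)) + sumFin b (λ j → f (a ↑ʳ j))
sumFin-++ zero    b f = refl
sumFin-++ (suc a) b f =
  trans (cong (f zero +_) (sumFin-++ a b (λ i → f (suc i)))) (sym (+-assoc (f zero) _ _))

sumFin-combine : ∀ m n (f : Fin (m * n) → ℕ) →
  sumFin (m * n) f ≡ sumFin m (λ i → sumFin n (λ j → f (combine i j)))
sumFin-combine zero    n f = refl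
sumFin-combine (suc m) n f =
  trans (sumFin-++ n (m * n) f)
    (cong (sumFin n (λ j → f (j ↑ˡ (m * n))) +_) (sumFin-combine m n (λ k → f (n ↑ʳ k))))

-- Counting Boolean assignments

ind : Bool → ℕ
ind true  = 1
ind false = 0

ind-mono : ∀ {a b} → (a ≡ true → b ≡ true) → ind a ≤ ind b
ind-mono {false} a⇒b = z≤n
ind-mono {true}  a⇒b rewrite a⇒b refl = ≤-refl

∧-≡true⁻ : ∀ {a b} → a ∧ b ≡ true → a ≡ true × b ≡ true
∧-≡true⁻ {true} b≡true = refl , b≡true

ind-∨ : ∀ a b → ind (a ∨ b) ≤ ind a + ind b
ind-∨ true  b = s≤s z≤n
ind-∨ false b = ≤-refl

count : (N : ℕ) → ((Fin N → Bool) → Bool) → ℕ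
count zero    P = ind (P []ᶠ)
count (suc N) P = count N (λ g → P (false ∷ᶠ g)) + count N (λ g → P (true ∷ᶠ g))

count-∧ˡ : ∀ N b (P : (Fin N → Bool) → Bool) → count N (λ f → b ∧ P f) ≡ ind b * count N P
count-∧ˡ zero    true  P = sym (+-identityʳ _)
count-∧ˡ zero    false P = refl
count-∧ˡ (suc N) b     P = begin
  count N (λ g → b ∧ P (false ∷ᶠ g)) + count N (λ g → b ∧ P (true ∷ᶠ g))
    ≡⟨ cong₂ _+_ (count-∧ˡ N b _) (count-∧ˡ N b _) ⟩
  ind b * count N (λ g → P (false ∷ᶠ g)) + ind b * count N (λ g → P (true ∷ᶠ g))
    ≡⟨ sym (*-distribˡ-+ (ind b) _ _) ⟩
  ind b * count (suc N) P ∎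
  where open ≡-Reasoning

count-∨ : ∀ N (P Q : (Fin N → Bool) → Bool) →
  count N (λ f → P f ∨ Q f) ≤ count N P + count N Q
count-∨ zero    P Q = ind-∨ (P []ᶠ) (Q []ᶠ)
count-∨ (suc N) P Q = ≤-trans (+-mono-≤ (count-∨ N _ _) (count-∨ N _ _))
  (≤-reflexive (+-interchange (count N (λ g → P (false ∷ᶠ g))) (count N (λ g → Q (false ∷ᶠ g))) _ _))

count-exists : ∀ N (P : (Fin N → Bool) → Bool) → count N P < 2 ^ N → ∃ λ f → P f ≡ false
count-exists zero    P c<1 with P []ᶠ in eq
... | false = []ᶠ , eq
... | true  = contradiction c<1 (<-irrefl refl)
count-exists (suc N) P c<2^N with count N (λ g → P (false ∷ᶠ g)) <? 2 ^ N
... | yes c₀<2^N = let g , eq = count-exists N _ c₀<2^N in false ∷ᶠ g , eq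
... | no  c₀≮2^N = let g , eq = count-exists N _ c₁<2^N in true ∷ᶠ g , eq
  where
  c₁<2^N : count N (λ g → P (true ∷ᶠ g)) < 2 ^ N
  c₁<2^N = +-cancelˡ-< (count N (λ g → P (false ∷ᶠ g))) _ _
    (<-≤-trans c<2^N (+-mono-≤ (≮⇒≥ c₀≮2^N) (≤-reflexive (+-identityʳ _))))

consistent : Maybe Bool → Bool → Bool
consistent nothing      x = true
consistent (just true)  x = x
consistent (just false) x = not x

agrees : ∀ N → (Fin N → Maybe Bool) → (Fin N → Bool) → Bool
agrees zero    c f = true
agrees (suc N) c f = consistent (head c) (head f) ∧ agrees N (tail c) (tail f)

fixed : ∀ N → (Fin N → Maybe Bool) → ℕ
fixed N c = sumFin N (λ i → ind (is-just (c i)))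

consistent-intro : ∀ m {x} → (∀ {b} → m ≡ just b → x ≡ b) → consistent m x ≡ true
consistent-intro nothing      _   = refl
consistent-intro (just true)  m⇒x = m⇒x refl
consistent-intro (just false) m⇒x rewrite m⇒x refl = refl

agrees-intro : ∀ N (c : Fin N → Maybe Bool) (f : Fin N → Bool) →
  (∀ i {b} → c i ≡ just b → f i ≡ b) → agrees N c f ≡ true
agrees-intro zero    c f c⇒f = refl
agrees-intro (suc N) c f c⇒f = cong₂ _∧_ (consistent-intro (c zero) (c⇒f zero))
                                          (agrees-intro N (tail c) (tail f) (λ i → c⇒f (suc i)))

count-agrees : ∀ N (c : Fin N → Maybe Bool) → count N (agrees N c) * 2 ^ fixed N c ≡ 2 ^ N
count-agrees zero    c = refl
count-agrees (suc N) c = begin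
  count (suc N) (agrees (suc N) c) * 2 ^ (k + K)
    ≡⟨ cong (_* 2 ^ (k + K)) (cong₂ _+_ (count-∧ˡ N (consistent m false) _)
                                        (count-∧ˡ N (consistent m true) _)) ⟩
  (a * C + b * C) * 2 ^ (k + K)
    ≡⟨ cong ((a * C + b * C) *_) (^-distribˡ-+-* 2 k K) ⟩
  (a * C + b * C) * (2 ^ k * 2 ^ K)
    ≡⟨ regroup a b C (2 ^ k) (2 ^ K) ⟩
  ((a + b) * 2 ^ k) * (C * 2 ^ K)
    ≡⟨ cong₂ _*_ (choices m) (count-agrees N (tail c)) ⟩
  2 * 2 ^ N ∎
  where
  open ≡-Reasoning
  open +-*-Solver
  m = head c
  k = ind (is-just m)
  a = ind (consistent m false)
  b = ind (consistent m true)
  C = count N (agrees N (tail c))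
  K = fixed N (tail c)
  regroup : ∀ a b x y z → (a * x + b * x) * (y * z) ≡ ((a + b) * y) * (x * z)
  regroup = solve 5 (λ a b x y z → (a :* x :+ b :* x) :* (y :* z) := ((a :+ b) :* y) :* (x :* z))
                    refl
  choices : ∀ m → (ind (consistent m false) + ind (consistent m true)) * 2 ^ ind (is-just m) ≡ 2
  choices nothing      = refl
  choices (just true)  = refl
  choices (just false) = refl

anyFin : ∀ m → (Fin m → Bool) → Bool
anyFin zero    p = false
anyFin (suc m) p = p zero ∨ anyFin m (λ i → p (suc i))

anyFin-intro : ∀ m (p : Fin m → Bool) i → p i ≡ true → anyFin m p ≡ true
anyFin-intro (suc m) p zero    pi≡true rewrite pi≡true = refl
anyFin-intro (suc m) p (suc i) pi≡true with p zero
... | true  = refl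
... | false = anyFin-intro m (λ j → p (suc j)) i pi≡true

count-anyFin : ∀ N m (P : Fin m → (Fin N → Bool) → Bool) →
  count N (λ f → anyFin m (λ i → P i f)) ≤ sumFin m (λ i → count N (P i))
count-anyFin N zero    P = ≤-reflexive (count-∧ˡ N false (λ _ → true))
count-anyFin N (suc m) P = ≤-trans (count-∨ N (P zero) _)
  (+-monoʳ-≤ (count N (P zero)) (count-anyFin N m (λ i → P (suc i))))

anyVec : ∀ n k → (Vec (Fin n) k → Bool) → Bool
anyVec n zero    p = p []
anyVec n (suc k) p = anyFin n (λ a → anyVec n k (λ s → p (a ∷ s)))

sumVec : ∀ n k → (Vec (Fin n) k → ℕ) → ℕ
sumVec n zero    h = h []
sumVec n (suc k) h = sumFin n (λ a → sumVec n k (λ s → h (a ∷ s)))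

anyVec-intro : ∀ n k (p : Vec (Fin n) k → Bool) s → p s ≡ true → anyVec n k p ≡ true
anyVec-intro n zero    p []      ps≡true = ps≡true
anyVec-intro n (suc k) p (a ∷ s) ps≡true =
  anyFin-intro n _ a (anyVec-intro n k (λ t → p (a ∷ t)) s ps≡true)

count-anyVec : ∀ N n k (P : Vec (Fin n) k → (Fin N → Bool) → Bool) →
  count N (λ f → anyVec n k (λ s → P s f)) ≤ sumVec n k (λ s → count N (P s))
count-anyVec N n zero    P = ≤-refl
count-anyVec N n (suc k) P = ≤-trans (count-anyFin N n (λ a f → anyVec n k (λ s → P (a ∷ s) f)))
  (sumFin-mono-≤ n (λ a → count-anyVec N n k (λ s → P (a ∷ s))))

sumVec-≤ : ∀ n k (h : Vec (Fin n) k → ℕ) c b → (∀ s → h s * c ≤ b) → sumVec n k h * c ≤ n ^ k * b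
sumVec-≤ n zero    h c b hc≤b = ≤-trans (hc≤b []) (≤-reflexive (sym (+-identityʳ b)))
sumVec-≤ n (suc k) h c b hc≤b = begin
  sumFin n (λ a → sumVec n k (λ s → h (a ∷ s))) * c
    ≡⟨ sumFin-distribʳ-* n _ c ⟩
  sumFin n (λ a → sumVec n k (λ s → h (a ∷ s)) * c)
    ≤⟨ sumFin-≤-* n (λ a → sumVec-≤ n k _ c b (λ s → hc≤b (a ∷ s))) ⟩
  n * (n ^ k * b)
    ≡⟨ *-assoc n (n ^ k) b ⟨
  n * n ^ k * b ∎
  where open ≤-Reasoning

-- Arithmetic

^-distribʳ-* : ∀ k a b → (a * b) ^ k ≡ a ^ k * b ^ k
^-distribʳ-* zero    a b = refl
^-distribʳ-* (suc k) a b =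
  trans (cong (a * b *_) (^-distribʳ-* k a b)) (*-interchange a b (a ^ k) (b ^ k))

^-cancelˡ-< : ∀ k {a b} → a ^ k < b ^ k → a < b
^-cancelˡ-< k a^k<b^k = ≰⇒> (λ b≤a → <⇒≱ a^k<b^k (^-monoˡ-≤ k b≤a))

*-self-cancel-≤ : ∀ {a b} → a * a ≤ b * b → a ≤ b
*-self-cancel-≤ a²≤b² = ≮⇒≥ (λ b<a → <⇒≱ (*-mono-< b<a b<a) a²≤b²)

<2^⇒exponent≢0 : ∀ {x e} → 1 ≤ x → x < 2 ^ e → e ≢ 0
<2^⇒exponent≢0 1≤x x<2^e refl = <⇒≱ x<2^e 1≤x

-- With d = 2m ≤ k(k-1), n^(2k) < 2^(d-k) forces n² < 2^(k-2); multiplying the two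
-- inequalities gives (2n·n^k)² ≤ 2^d.
dense⇒2n·n^k≤2^m : ∀ n .{{_ : NonZero n}} k m → m + m ≤ k * (k ∸ 1) →
  n ^ (2 * k) < 2 ^ (m + m ∸ k) → 2 * n * n ^ k ≤ 2 ^ m
dense⇒2n·n^k≤2^m n k m d≤k[k-1] n^2k<2^[d-k] = *-self-cancel-≤ (begin
  (2 * n * P) * (2 * n * P)          ≡⟨ square n P ⟩
  (P * P) * ((n * n) * 4)            ≤⟨ *-mono-≤ (<⇒≤ P²<2^[d-k]) (*-monoˡ-≤ 4 (<⇒≤ n²<2^[k-2])) ⟩
  2 ^ (d ∸ k) * (2 ^ (k ∸ 2) * 4)    ≡⟨ cong (2 ^ (d ∸ k) *_) 2^[k-2]*4≡2^k ⟩
  2 ^ (d ∸ k) * 2 ^ k                ≡⟨ ^-distribˡ-+-* 2 (d ∸ k) k ⟨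
  2 ^ (d ∸ k + k)                    ≡⟨ cong (2 ^_) (m∸n+n≡m k≤d) ⟩
  2 ^ (m + m)                        ≡⟨ ^-distribˡ-+-* 2 m m ⟩
  2 ^ m * 2 ^ m                      ∎)
  where
  open ≤-Reasoning
  open +-*-Solver
  d = m + m
  P = n ^ k
  square : ∀ n P → (2 * n * P) * (2 * n * P) ≡ (P * P) * ((n * n) * 4)
  square = solve 2 (λ n P → (con 2 :* n :* P) :* (con 2 :* n :* P) := (P :* P) :* ((n :* n) :* con 4))
                   refl
  P²<2^[d-k] : P * P < 2 ^ (d ∸ k)
  P²<2^[d-k] = subst (_< 2 ^ (d ∸ k))
    (trans (^-distribˡ-+-* n k (k + 0)) (cong (λ e → P * n ^ e) (+-identityʳ k))) n^2k<2^[d-k]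
  d-k≤[k-2]k : d ∸ k ≤ (k ∸ 2) * k
  d-k≤[k-2]k = begin
    d ∸ k                 ≤⟨ ∸-monoˡ-≤ k d≤k[k-1] ⟩
    k * (k ∸ 1) ∸ k       ≡⟨ cong₂ _∸_ (*-comm k (k ∸ 1)) (sym (*-identityˡ k)) ⟩
    (k ∸ 1) * k ∸ 1 * k   ≡⟨ *-distribʳ-∸ k (k ∸ 1) 1 ⟨
    (k ∸ 1 ∸ 1) * k       ≡⟨ cong (_* k) (∸-+-assoc k 1 1) ⟩
    (k ∸ 2) * k           ∎
  n²<2^[k-2] : n * n < 2 ^ (k ∸ 2)
  n²<2^[k-2] = ^-cancelˡ-< k (begin-strict
    (n * n) ^ k            ≡⟨ ^-distribʳ-* k n n ⟩
    P * P                  <⟨ P²<2^[d-k] ⟩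
    2 ^ (d ∸ k)            ≤⟨ ^-monoʳ-≤ 2 d-k≤[k-2]k ⟩
    2 ^ ((k ∸ 2) * k)      ≡⟨ ^-*-assoc 2 (k ∸ 2) k ⟨
    (2 ^ (k ∸ 2)) ^ k      ∎)
  k∸2≢0 : k ∸ 2 ≢ 0
  k∸2≢0 = <2^⇒exponent≢0 (*-mono-≤ (>-nonZero⁻¹ n) (>-nonZero⁻¹ n)) n²<2^[k-2]
  2^[k-2]*4≡2^k : 2 ^ (k ∸ 2) * 4 ≡ 2 ^ k
  2^[k-2]*4≡2^k = trans (sym (^-distribˡ-+-* 2 (k ∸ 2) 2))
    (cong (2 ^_) (m∸n+n≡m {k} {2} (<⇒≤ (m∸n≢0⇒n<m k∸2≢0))))
  k≤d : k ≤ d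
  k≤d = <⇒≤ (m∸n≢0⇒n<m (<2^⇒exponent≢0 (*-mono-≤ (m^n>0 n k) (m^n>0 n k)) P²<2^[d-k]))

-- Subsets and vertex sequences

∣p∣≡sum : ∀ {n} (X : Subset n) → ∣ X ∣ ≡ sumFin n (λ i → ind (lookup X i))
∣p∣≡sum []            = refl
∣p∣≡sum (inside  ∷ X) = cong suc (∣p∣≡sum X)
∣p∣≡sum (outside ∷ X) = ∣p∣≡sum X

x∈p⇒∣p∣≡1+∣p-x∣ : ∀ {n} {X : Subset n} {x} → x ∈ X → ∣ X ∣ ≡ suc ∣ X - x ∣
x∈p⇒∣p∣≡1+∣p-x∣ {X = inside  ∷ X} here        = cong suc (sym (cong ∣_∣ (p─⊥≡p X)))
x∈p⇒∣p∣≡1+∣p-x∣ {X = inside  ∷ X} (there x∈X) = cong suc (x∈p⇒∣p∣≡1+∣p-x∣ x∈X)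
x∈p⇒∣p∣≡1+∣p-x∣ {X = outside ∷ X} (there x∈X) = x∈p⇒∣p∣≡1+∣p-x∣ x∈X

x∈p⇒⁅x⁆∪p-x≡p : ∀ {n} {X : Subset n} {x} → x ∈ X → ⁅ x ⁆ ∪ (X - x) ≡ X
x∈p⇒⁅x⁆∪p-x≡p {X = inside ∷ X} here        = cong (inside ∷_) (trans (∪-identityˡ _) (p─⊥≡p X))
x∈p⇒⁅x⁆∪p-x≡p {X = s ∷ X} (there x∈X) = cong (s ∷_) (x∈p⇒⁅x⁆∪p-x≡p x∈X)

toSet : ∀ {n k} → Vec (Fin n) k → Subset n
toSet []      = ⊥
toSet (w ∷ s) = ⁅ w ⁆ ∪ toSet s

x∈⁅y⁆∪p⇒x∈p : ∀ {n} {x : Fin n} y X → x ∈ ⁅ y ⁆ ∪ X → y ≢ x → x ∈ X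
x∈⁅y⁆∪p⇒x∈p y X x∈y∪X y≢x with x∈p∪q⁻ ⁅ y ⁆ X x∈y∪X
... | inj₁ x∈⁅y⁆ = contradiction (sym (x∈⁅y⁆⇒x≡y y x∈⁅y⁆)) y≢x
... | inj₂ x∈X   = x∈X

before : ∀ {n k} → Vec (Fin n) k → Fin n → Fin n → Bool
before []      a b = false
before (w ∷ s) a b = does (w ≟ᶠ a) ∨ (not (does (w ≟ᶠ b)) ∧ before s a b)

-- Sinks and sink-first orderings

Adj⇒≢ : ∀ {n} (G : Graph n) {u v} → Adj G u v ≡ true → u ≢ v
Adj⇒≢ G {u} uv refl = contradiction (trans (sym uv) (irrefl G u)) λ ()

module _ {n} {G : Graph n} (D : Orientation G) where

  Walk-mono : ∀ {X Y u v} → X ⊆ Y → Walk D X u v → Walk D Y u v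
  Walk-mono X⊆Y (arc u∈X v∈X uv) = arc (X⊆Y u∈X) (X⊆Y v∈X) uv
  Walk-mono X⊆Y (p ∷ q)          = Walk-mono X⊆Y p ∷ Walk-mono X⊆Y q

  Acyclic-anti : ∀ {X Y} → X ⊆ Y → Acyclic D Y → Acyclic D X
  Acyclic-anti X⊆Y acyclic v cycle = acyclic v (Walk-mono X⊆Y cycle)

  HasSuccessorIn : Subset n → Fin n → Set
  HasSuccessorIn X w = ∃ λ x → x ∈ X × Arc D w x ≡ true

  successor? : ∀ {X} w → Dec (HasSuccessorIn X w)
  successor? {X} w = any? (λ x → x ∈? X ×-dec Arc D w x ≟ᵇ true)

  module _ {X w₀} (next : ∀ {w} → w ∈ X → HasSuccessorIn X w) (w₀∈X : w₀ ∈ X) where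

    private
      path : ℕ → ∃ λ v → v ∈ X
      path zero    = w₀ , w₀∈X
      path (suc i) = let _ , v∈X = path i ; x , x∈X , _ = next v∈X in x , x∈X

      vertex : ℕ → Fin n
      vertex i = proj₁ (path i)

      step : ∀ i → Walk D X (vertex i) (vertex (suc i))
      step i = let _ , v∈X = path i ; _ , x∈X , vx = next v∈X in arc v∈X x∈X vx

      walk : ∀ {i j} → i < j → Walk D X (vertex i) (vertex j)
      walk {i} {suc j} (s≤s i≤j) with m≤n⇒m<n∨m≡n i≤j
      ... | inj₁ i<j  = walk i<j ∷ step j
      ... | inj₂ refl = step i

    -- Among the first n + 1 vertices of the successor path two coincide (pigeonhole).
    successors⇒cycle : ∃ λ v → Walk D X v v
    successors⇒cycle with pigeonhole (n<1+n n) (λ (i : Fin (suc n)) → vertex (toℕ i))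
    ... | i , j , i<j , vᵢ≡vⱼ =
      vertex (toℕ i) , subst (Walk D X (vertex (toℕ i))) (sym vᵢ≡vⱼ) (walk i<j)

  acyclic⇒sink : ∀ {X w₀} → Acyclic D X → w₀ ∈ X → ∃ λ w → w ∈ X × ¬ HasSuccessorIn X w
  acyclic⇒sink {X} acyclic w₀∈X with any? (λ w → w ∈? X ×-dec ¬? (successor? w))
  ... | yes sink     = sink
  ... | no  no-sink = contradiction (proj₂ (successors⇒cycle next w₀∈X)) (acyclic _)
    where
    next : ∀ {w} → w ∈ X → HasSuccessorIn X w
    next {w} w∈X = decidable-stable (successor? w) (λ none → no-sink (w , w∈X , none))

  -- A reverse topological ordering: arcs between entries of s point towards the front.
  SinkFirst : ∀ {k} → Vec (Fin n) k → Set
  SinkFirst []      = ⊤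
  SinkFirst (w ∷ s) = (∀ {x} → x ∈ toSet s → Adj G w x ≡ true → Arc D x w ≡ true) × SinkFirst s

  SinkFirst⇒Arc≡before : ∀ {k} (s : Vec (Fin n) k) → SinkFirst s →
    ∀ {u v} → u ∈ toSet s → v ∈ toSet s → Adj G u v ≡ true → Arc D u v ≡ before s v u
  SinkFirst⇒Arc≡before []      _ u∈⊥ = contradiction u∈⊥ ∉⊥
  SinkFirst⇒Arc≡before (w ∷ s) (into-w , sorted) {u} {v} u∈ v∈ uv with w ≟ᶠ v | w ≟ᶠ u
  ... | yes refl | yes refl = contradiction refl (Adj⇒≢ G uv)
  ... | yes refl | no  w≢u  = into-w (x∈⁅y⁆∪p⇒x∈p w (toSet s) u∈ w≢u) (trans (Adj-sym G w u) uv)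
  ... | no  w≢v  | yes refl = notBoth D v w (into-w (x∈⁅y⁆∪p⇒x∈p w (toSet s) v∈ w≢v) uv)
  ... | no  w≢v  | no  w≢u  = SinkFirst⇒Arc≡before s sorted
    (x∈⁅y⁆∪p⇒x∈p w (toSet s) u∈ w≢u) (x∈⁅y⁆∪p⇒x∈p w (toSet s) v∈ w≢v) uv

  acyclic⇒sinkFirst : ∀ k {X} → ∣ X ∣ ≡ k → Acyclic D X →
    Σ (Vec (Fin n) k) λ s → toSet s ≡ X × SinkFirst s
  acyclic⇒sinkFirst zero {X} ∣X∣≡0 _ =
    [] , sym (Empty-unique (λ (x , x∈X) → 0≢1+n (trans (sym ∣X∣≡0) (x∈p⇒∣p∣≡1+∣p-x∣ x∈X)))) , tt
  acyclic⇒sinkFirst (suc k) {X} ∣X∣≡1+k acyclic with nonempty? X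
  ... | no  empty =
    contradiction (trans (sym ∣X∣≡1+k) (trans (cong ∣_∣ (Empty-unique empty)) (∣⊥∣≡0 n))) λ ()
  ... | yes (_ , w₀∈X) with acyclic⇒sink acyclic w₀∈X
  ... | w , w∈X , sink
    with acyclic⇒sinkFirst k {X - w} (suc-injective (trans (sym (x∈p⇒∣p∣≡1+∣p-x∣ w∈X)) ∣X∣≡1+k))
                                     (Acyclic-anti (p─q⊆p X ⁅ w ⁆) acyclic)
  ... | s , s≡X-w , sorted =
    w ∷ s , trans (cong (⁅ w ⁆ ∪_) s≡X-w) (x∈p⇒⁅x⁆∪p-x≡p w∈X) , into-w , sorted
    where
    into-w : ∀ {x} → x ∈ toSet s → Adj G w x ≡ true → Arc D x w ≡ true
    into-w {x} x∈s wx with edge⇒arc D w x wx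
    ... | inj₁ w→x = contradiction (x , p─q⊆p X ⁅ w ⁆ (subst (x ∈_) s≡X-w x∈s) , w→x) sink
    ... | inj₂ x→w = x→w

-- Orientations from bits, and edge counts

<?ᶠ-flip : ∀ {n} {u v : Fin n} → u ≢ v → does (v <?ᶠ u) ≡ not (does (u <?ᶠ v))
<?ᶠ-flip {u = u} {v} u≢v with <-cmp u v
... | tri< u<v _ v≮u rewrite dec-true (u <?ᶠ v) u<v | dec-false (v <?ᶠ u) v≮u = refl
... | tri≈ _ u≡v _   = contradiction u≡v u≢v
... | tri> u≮v _ v<u rewrite dec-false (u <?ᶠ v) u≮v | dec-true (v <?ᶠ u) v<u = refl

module _ {n} (G : Graph n) where

  arcBy : (Fin n → Fin n → Bool) → Fin n → Fin n → Bool
  arcBy b u v = Adj G u v ∧ (if does (u <?ᶠ v) then b u v else not (b v u))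

  arcBy⇒Adj : ∀ b {u v} → arcBy b u v ≡ true → Adj G u v ≡ true
  arcBy⇒Adj b uv = proj₁ (∧-≡true⁻ uv)

  arcBy-flip : ∀ b {u v} → Adj G u v ≡ true → arcBy b v u ≡ not (arcBy b u v)
  arcBy-flip b {u} {v} uv rewrite Adj-sym G v u | uv | <?ᶠ-flip (Adj⇒≢ G uv) with does (u <?ᶠ v)
  ... | true  = refl
  ... | false = sym (not-involutive (b v u))

  arcBy-total : ∀ b {u v} → Adj G u v ≡ true → arcBy b u v ≡ true ⊎ arcBy b v u ≡ true
  arcBy-total b {u} {v} uv with arcBy b u v in u→v
  ... | true  = inj₁ refl
  ... | false = inj₂ (trans (arcBy-flip b uv) (cong not u→v))

  arcBy-forward : ∀ b {u v} → Adj G u v ≡ true → does (u <?ᶠ v) ≡ true → arcBy b u v ≡ b u v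
  arcBy-forward b uv u<v rewrite uv | u<v = refl

  orientBy : (Fin n → Fin n → Bool) → Orientation G
  orientBy b = record
    { Arc      = arcBy b
    ; arc⇒edge = λ u v → arcBy⇒Adj b
    ; edge⇒arc = λ u v → arcBy-total b
    ; notBoth  = λ u v uv → trans (arcBy-flip b (arcBy⇒Adj b uv)) (cong not uv)
    }

  forwardEdge : Subset n → Fin n → Fin n → Bool
  forwardEdge X u v = lookup X u ∧ lookup X v ∧ Adj G u v ∧ does (u <?ᶠ v)

  edges : Subset n → ℕ
  edges X = sumFin n (λ u → sumFin n (λ v → ind (forwardEdge X u v)))

  private
    degSum-entry : ∀ X u v →
      (if lookup X u then (if lookup X v then (if Adj G u v then 1 else 0) else 0) else 0) ≡
      ind (lookup X u ∧ lookup X v ∧ Adj G u v)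
    degSum-entry X u v with lookup X u | lookup X v | Adj G u v
    ... | true  | true  | true  = refl
    ... | true  | true  | false = refl
    ... | true  | false | _     = refl
    ... | false | _     | _     = refl

    edge-split : ∀ X u v →
      ind (lookup X u ∧ lookup X v ∧ Adj G u v) ≡ ind (forwardEdge X u v) + ind (forwardEdge X v u)
    edge-split X u v rewrite Adj-sym G v u with lookup X u | lookup X v | Adj G u v in uv
    ... | false | false | _     = refl
    ... | false | true  | _     = refl
    ... | true  | false | _     = refl
    ... | true  | true  | false = refl
    ... | true  | true  | true rewrite <?ᶠ-flip (Adj⇒≢ G uv) with does (u <?ᶠ v)
    ...   | true  = refl
    ...   | false = refl

  degSum-cong : ∀ X {f : Fin n → Fin n → ℕ} →
    (∀ u v → ind (lookup X u ∧ lookup X v ∧ Adj G u v) ≡ f u v) →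
    degSum G X ≡ sumFin n (λ u → sumFin n (f u))
  degSum-cong X entry =
    sumFin-cong n (λ u → sumFin-cong n (λ v → trans (degSum-entry X u v) (entry u v)))

  degSum≡edges+edges : ∀ X → degSum G X ≡ edges X + edges X
  degSum≡edges+edges X = begin
    degSum G X
      ≡⟨ degSum-cong X (edge-split X) ⟩
    sumFin n (λ u → sumFin n (λ v → ind (forwardEdge X u v) + ind (forwardEdge X v u)))
      ≡⟨ sumFin-cong n (λ u → sumFin-distrib-+ n _ _) ⟩
    sumFin n (λ u → sumFin n (λ v → ind (forwardEdge X u v)) + sumFin n (λ v → ind (forwardEdge X v u)))
      ≡⟨ sumFin-distrib-+ n _ _ ⟩
    edges X + sumFin n (λ u → sumFin n (λ v → ind (forwardEdge X v u)))
      ≡⟨ cong (edges X +_) (sumFin-comm n n (λ u v → ind (forwardEdge X v u))) ⟩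
    edges X + edges X ∎
    where open ≡-Reasoning

  degSum≤∣p∣[∣p∣-1] : ∀ X → degSum G X ≤ ∣ X ∣ * (∣ X ∣ ∸ 1)
  degSum≤∣p∣[∣p∣-1] X = begin
    degSum G X
      ≡⟨ degSum-cong X (λ _ _ → refl) ⟩
    sumFin n (λ u → sumFin n (λ v → ind (lookup X u ∧ lookup X v ∧ Adj G u v)))
      ≤⟨ sumFin-mono-≤ n row≤ ⟩
    sumFin n (λ u → ind (lookup X u) * (∣ X ∣ ∸ 1))
      ≡⟨ sumFin-distribʳ-* n _ _ ⟨
    sumFin n (λ u → ind (lookup X u)) * (∣ X ∣ ∸ 1)
      ≡⟨ cong (_* (∣ X ∣ ∸ 1)) (∣p∣≡sum X) ⟨
    ∣ X ∣ * (∣ X ∣ ∸ 1) ∎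
    where
    open ≤-Reasoning
    row≤ : ∀ u → sumFin n (λ v → ind (lookup X u ∧ lookup X v ∧ Adj G u v)) ≤
                 ind (lookup X u) * (∣ X ∣ ∸ 1)
    row≤ u with lookup X u in u∈X
    ... | false = ≤-trans (sumFin-≤-* n {b = 0} (λ _ → z≤n)) (≤-reflexive (*-zeroʳ n))
    ... | true  = begin
      sumFin n (λ v → ind (lookup X v ∧ Adj G u v))
        ≤⟨ sumFin-mono-≤ n (λ v → ind-mono (neighbour∈X-u v)) ⟩
      sumFin n (λ v → ind (lookup (X - u) v))
        ≡⟨ ∣p∣≡sum (X - u) ⟨
      ∣ X - u ∣
        ≡⟨ cong (_∸ 1) (x∈p⇒∣p∣≡1+∣p-x∣ (lookup⇒[]= u X u∈X)) ⟨
      ∣ X ∣ ∸ 1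
        ≡⟨ +-identityʳ (∣ X ∣ ∸ 1) ⟨
      1 * (∣ X ∣ ∸ 1) ∎
      where
      neighbour∈X-u : ∀ v → lookup X v ∧ Adj G u v ≡ true → lookup (X - u) v ≡ true
      neighbour∈X-u v v∈X∧uv = let v∈X , uv = ∧-≡true⁻ v∈X∧uv in
        []=⇒lookup (x∈p∧x≢y⇒x∈p-y (lookup⇒[]= v X v∈X) (λ v≡u → Adj⇒≢ G uv (sym v≡u)))

  LogSparse? : ∀ X → Dec (LogSparse G X)
  LogSparse? X = _ ≤? _

  ∣p∣≡0⇒LogSparse : ∀ {X} → ∣ X ∣ ≡ 0 → LogSparse G X
  ∣p∣≡0⇒LogSparse {X} ∣X∣≡0 with degSum≤∣p∣[∣p∣-1] X
  ... | degSum≤ rewrite ∣X∣≡0 | n≤0⇒n≡0 degSum≤ = ≤-refl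

-- The counting argument

module Counting {n} {{_ : NonZero n}} (G : Graph n) where

  N : ℕ
  N = n * n

  pairBit : (Fin N → Bool) → Fin n → Fin n → Bool
  pairBit f u v = f (combine u v)

  orientation : (Fin N → Bool) → Orientation G
  orientation f = orientBy G (pairBit f)

  -- The bits that orientation f must have for s to be sink-first.
  constraint : ∀ {k} → Vec (Fin n) k → Fin n → Fin n → Maybe Bool
  constraint s u v = if forwardEdge G (toSet s) u v then just (before s v u) else nothing

  constraints : ∀ {k} → Vec (Fin n) k → Fin N → Maybe Bool
  constraints s i = let u , v = remQuot {n} n i in constraint s u v

  fixed-constraints : ∀ {k} (s : Vec (Fin n) k) → fixed N (constraints s) ≡ edges G (toSet s)
  fixed-constraints s = trans (sumFin-combine n n _) (sumFin-cong n λ u → sumFin-cong n λ v →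
    trans (cong (λ (u , v) → ind (is-just (constraint s u v))) (remQuot-combine u v))
          (is-just-constraint u v))
    where
    is-just-constraint : ∀ u v → ind (is-just (constraint s u v)) ≡ ind (forwardEdge G (toSet s) u v)
    is-just-constraint u v with forwardEdge G (toSet s) u v
    ... | true  = refl
    ... | false = refl

  sinkFirst⇒agrees : ∀ f {k} (s : Vec (Fin n) k) → SinkFirst (orientation f) s →
    agrees N (constraints s) f ≡ true
  sinkFirst⇒agrees f s sorted = agrees-intro N (constraints s) f λ i c≡b →
    let u , v = remQuot {n} n i in
    trans (cong f (sym (combine-remQuot {n} n i))) (constraint-sound u v c≡b)
    where
    constraint-sound : ∀ u v {b} → constraint s u v ≡ just b → pairBit f u v ≡ b
    constraint-sound u v c≡b with forwardEdge G (toSet s) u v in fwd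
    constraint-sound u v refl | true =
      let u∈ , v∈∧uv∧u<v = ∧-≡true⁻ fwd
          v∈ , uv∧u<v    = ∧-≡true⁻ v∈∧uv∧u<v
          uv , u<v       = ∧-≡true⁻ uv∧u<v
      in
      trans (sym (arcBy-forward G (pairBit f) uv u<v))
            (SinkFirst⇒Arc≡before (orientation f) s sorted
              (lookup⇒[]= u _ u∈) (lookup⇒[]= v _ v∈) uv)

  Dense : ∀ {k} → Vec (Fin n) k → Set
  Dense {k} s = ∣ toSet s ∣ ≡ k × ¬ LogSparse G (toSet s)

  dense? : ∀ {k} (s : Vec (Fin n) k) → Dec (Dense s)
  dense? {k} s = ∣ toSet s ∣ ≟ k ×-dec ¬? (LogSparse? G (toSet s))

  BadFor : ∀ {k} → Vec (Fin n) k → (Fin N → Bool) → Bool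
  BadFor s f = does (dense? s) ∧ agrees N (constraints s) f

  count-BadFor : ∀ {k} (s : Vec (Fin n) k) → count N (BadFor s) * (2 * n * n ^ k) ≤ 2 ^ N
  count-BadFor {k} s = begin
    count N (BadFor s) * (2 * n * n ^ k)
      ≡⟨ cong (_* (2 * n * n ^ k)) (count-∧ˡ N (does (dense? s)) _) ⟩
    ind (does (dense? s)) * C * (2 * n * n ^ k)
      ≤⟨ if-dense (dense? s) ⟩
    2 ^ N ∎
    where
    open ≤-Reasoning
    X = toSet s
    C = count N (agrees N (constraints s))
    if-dense : (d : Dec (Dense s)) → ind (does d) * C * (2 * n * n ^ k) ≤ 2 ^ N
    if-dense (no _)                 = z≤n
    if-dense (yes (∣X∣≡k , dense)) = begin
      (C + 0) * (2 * n * n ^ k)        ≡⟨ cong (_* (2 * n * n ^ k)) (+-identityʳ C) ⟩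
      C * (2 * n * n ^ k)              ≤⟨ *-monoʳ-≤ C 2n·n^k≤2^m ⟩
      C * 2 ^ edges G X                ≡⟨ cong (λ m → C * 2 ^ m) (fixed-constraints s) ⟨
      C * 2 ^ fixed N (constraints s)  ≡⟨ count-agrees N (constraints s) ⟩
      2 ^ N                            ∎
      where
      2n·n^k≤2^m : 2 * n * n ^ k ≤ 2 ^ edges G X
      2n·n^k≤2^m = dense⇒2n·n^k≤2^m n k (edges G X)
        (subst₂ _≤_ (degSum≡edges+edges G X) (cong (λ k → k * (k ∸ 1)) ∣X∣≡k)
                    (degSum≤∣p∣[∣p∣-1] G X))
        (subst₂ (λ d k → n ^ (2 * k) < 2 ^ (d ∸ k)) (degSum≡edges+edges G X) ∣X∣≡k (≰⇒> dense))

  Bad : (Fin N → Bool) → Bool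
  Bad f = anyFin n (λ j → anyVec n (suc (toℕ j)) (λ s → BadFor s f))

  Bad-intro : ∀ {f k} (s : Vec (Fin n) (suc k)) → k < n → BadFor s f ≡ true → Bad f ≡ true
  Bad-intro {f} {k} s k<n bad = anyFin-intro n _ (fromℕ< k<n)
    (subst (λ k → anyVec n (suc k) (λ s → BadFor s f) ≡ true) (sym (toℕ-fromℕ< k<n))
      (anyVec-intro n (suc k) (λ s → BadFor s f) s bad))

  -- Each size contributes at most 2^N / 2n, and there are n sizes.
  count-Bad<2^N : count N Bad < 2 ^ N
  count-Bad<2^N = half<whole (*-cancelʳ-≤ (count N Bad * 2) (2 ^ N) n (begin
    count N Bad * 2 * n                     ≡⟨ *-assoc (count N Bad) 2 n ⟩
    count N Bad * (2 * n)                   ≤⟨ *-monoˡ-≤ (2 * n) union-bound ⟩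
    sumFin n level * (2 * n)                ≡⟨ sumFin-distribʳ-* n level (2 * n) ⟩
    sumFin n (λ j → level j * (2 * n))      ≤⟨ sumFin-≤-* n level≤ ⟩
    n * 2 ^ N                               ≡⟨ *-comm n (2 ^ N) ⟩
    2 ^ N * n                               ∎))
    where
    open ≤-Reasoning
    level : Fin n → ℕ
    level j = sumVec n (suc (toℕ j)) (λ s → count N (BadFor s))
    union-bound : count N Bad ≤ sumFin n level
    union-bound = ≤-trans (count-anyFin N n _)
      (sumFin-mono-≤ n (λ j → count-anyVec N n (suc (toℕ j)) BadFor))
    level≤ : ∀ j → level j * (2 * n) ≤ 2 ^ N
    level≤ j = let k = suc (toℕ j) in *-cancelʳ-≤ _ _ (n ^ k) {{m^n≢0 n k}} (begin
      level j * (2 * n) * n ^ k     ≡⟨ *-assoc (level j) (2 * n) (n ^ k) ⟩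
      level j * (2 * n * n ^ k)     ≤⟨ sumVec-≤ n k (λ s → count N (BadFor s)) _ _ count-BadFor ⟩
      n ^ k * 2 ^ N                 ≡⟨ *-comm (n ^ k) (2 ^ N) ⟩
      2 ^ N * n ^ k                 ∎)
    half<whole : ∀ {c} → c * 2 ≤ 2 ^ N → c < 2 ^ N
    half<whole {zero}  _      = m^n>0 2 N
    half<whole {suc c} 2c≤2^N = <-≤-trans (m<m*n (suc c) 2 ≤-refl) 2c≤2^N

  acyclic-dense⇒Bad : ∀ f {X} → Acyclic (orientation f) X → ¬ LogSparse G X → Bad f ≡ true
  acyclic-dense⇒Bad f {X} acyclic dense = of-size ∣ X ∣ refl
    where
    of-size : ∀ m → ∣ X ∣ ≡ m → Bad f ≡ true
    of-size zero    ∣X∣≡0   = contradiction (∣p∣≡0⇒LogSparse G {X} ∣X∣≡0) dense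
    of-size (suc k) ∣X∣≡1+k =
      let s , s≡X , sinkFirst = acyclic⇒sinkFirst (orientation f) (suc k) ∣X∣≡1+k acyclic
          s-dense = subst (λ Y → ∣ Y ∣ ≡ suc k × ¬ LogSparse G Y) (sym s≡X) (∣X∣≡1+k , dense)
      in Bad-intro s (subst (_≤ n) ∣X∣≡1+k (∣p∣≤n X))
           (cong₂ _∧_ (dec-true (dense? s) s-dense) (sinkFirst⇒agrees f s sinkFirst))

  ¬Bad⇒LogSparse : ∀ f → Bad f ≡ false → ∀ X → Acyclic (orientation f) X → LogSparse G X
  ¬Bad⇒LogSparse f ¬bad X acyclic with LogSparse? G X
  ... | yes sparse = sparse
  ... | no  dense  = contradiction (trans (sym (acyclic-dense⇒Bad f acyclic dense)) ¬bad) λ ()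

mainTheorem1 : (n : ℕ) (G : Graph n) →
    Σ (Orientation G) (λ D → (X : Subset n) → Acyclic D X → LogSparse G X)
mainTheorem1 zero    G = orientBy G (λ _ _ → false) , λ { [] _ → ∣p∣≡0⇒LogSparse G {[]} refl }
mainTheorem1 (suc n) G =
  let f , ¬bad = count-exists N Bad count-Bad<2^N in orientation f , ¬Bad⇒LogSparse f ¬bad
  where open Counting G
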